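{- Let $p\ge2$ and $q\ge1$ be integers and let $r>0$, $\kappa>0$ be reals. Let $(G,\phi)$ be a $(0,\kappa]$-weighted graph. If $(G,\phi)$ does not contain the complete bipartite graph $K_{2,p}$ as a $q$-fat minor, then $V(G)$ is the union of two sets whose $r$-components are $(5r+9q+9\kappa)p$-bounded.
   Context: A weighted graph $(G,\phi)$ is a finite simple graph with $\phi:E(G)\to\mathbb{R}^+$; $d_{(G,\phi)}(x,y)$ is the minimum total weight of a path between $x$ and $y$ ($\infty$ if none); for sets $A,B$, $d_{(G,\phi)}(A,B)=\min\{d_{(G,\phi)}(u,v):u\in A,v\in B\}$. It is $(0,\kappa]$-weighted if all weights lie in $(0,\kappa]$. A set is $D$-bounded if its diameter (w.r.t. $d_{(G,\phi)}$) is at most $D$. For $A\subseteq V(G)$, two points $x,x'\in A$ are $r$-connected in $A$ if there are $x_1=x,\dots,x_\ell=x'$ in $A$ with $d_{(G,\phi)}(x_i,x_{i+1})\le r$; an $r$-component of $A$ is a maximal set of pairwise $r$-connected points of $A$. For an integer $q\ge1$, $(G,\phi)$ contains a graph $H$ as a $q$-fat minor if there are pairwise disjoint sets $T_v\subseteq V(G)$ ($v\in V(H)$), each inducing a connected subgraph of $G$, with $d_{(G,\phi)}(T_u,T_v)\ge q$ for $u\ne v$, and for every edge $uv\in E(H)$ a path $P_{uv}$ in $G$ joining $T_u$ and $T_v$, such that for distinct edges $uv,xy$ of $H$ the paths $P_{uv},P_{xy}$ are at distance at least $q$, and for every edge $uv$ and every vertex $w\notin\{u,v\}$ of $H$, $P_{uv}$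 is at distance at least $q$ from $T_w$. -}

module Defs where

open import Level using (0ℓ)
open import Data.Nat as ℕ using (ℕ; zero; suc)
open import Data.Fin as F using (Fin; toℕ)
open import Data.Bool using (Bool; true; false; _xor_)
open import Data.List using (List; []; _∷_)
open import Data.List.Relation.Unary.All using (All)
open import Data.List.Relation.Unary.Unique.Propositional using (Unique)
open import Data.List.Membership.Propositional using (_∈_)
open import Data.Product using (Σ; ∃; _×_; _,_)
open import Data.Sum using (_⊎_)
open import Data.Empty using (⊥)
open import Relation.Nullary using (¬_)
open import Relation.Binary.PropositionalEquality using (_≡_; _≢_)
open import Relation.Binary.Structures using (IsStrictTotalOrder)
open import Algebra.Structures using (IsCommutativeRing)

-- The real numbers, axiomatised as a (Dedekind-)complete ordered field.
-- (The standard library has no reals; any model of this record is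
-- isomorphic to ℝ, so quantifying over all models is exactly "over ℝ".)

record RealNumbers : Set₁ where
  infixl 6 _+_
  infixl 7 _*_
  infix 4 _<_ _≤_
  field
    ℝ   : Set
    0r 1r : ℝ
    _+_ _*_ : ℝ → ℝ → ℝ
    -_  : ℝ → ℝ
    _<_ : ℝ → ℝ → Set
    isCommutativeRing : IsCommutativeRing _≡_ _+_ _*_ -_ 0r 1r
    0≢1     : 0r ≢ 1r
    inverse : ∀ x → x ≢ 0r → ∃ λ y → x * y ≡ 1r
    isStrictTotalOrder : IsStrictTotalOrder _≡_ _<_
    +-mono-< : ∀ x y z → x < y → x + z < y + z
    *-pos    : ∀ x y → 0r < x → 0r < y → 0r < x * y

  _≤_ : ℝ → ℝ → Set
  x ≤ y = x < y ⊎ x ≡ y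

  field
    complete : (S : ℝ → Set) → ∃ S → (∃ λ b → ∀ x → S x → x ≤ b) →
               ∃ λ s → (∀ x → S x → x ≤ s) ×
                       (∀ b → (∀ x → S x → x ≤ b) → s ≤ b)

  fromℕ : ℕ → ℝ
  fromℕ zero    = 0r
  fromℕ (suc n) = 1r + fromℕ n

module WithReals (Rs : RealNumbers) where
  open RealNumbers Rs

  -- Values of φ on non-adjacent pairs are irrelevant.
  record WGraph : Set₁ where
    field
      n         : ℕ
      Adj       : Fin n → Fin n → Bool
      Adj-sym   : ∀ u v → Adj u v ≡ Adj v u
      Adj-irr   : ∀ u → Adj u u ≡ false
      φ         : Fin n → Fin n → ℝ
      φ-sym     : ∀ u v → φ u v ≡ φ v u
      φ-pos     : ∀ u v → Adj u v ≡ true → 0r < φ u v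

  module _ (G : WGraph) where
    open WGraph G

    Weighted0κ : ℝ → Set
    Weighted0κ κ = ∀ u v → Adj u v ≡ true → φ u v ≤ κ

    Pred : Set₁
    Pred = Fin n → Set

    data Walk : Fin n → Fin n → Set where
      [_]   : ∀ x → Walk x x
      _∷⟨_⟩_ : ∀ {y z} x → Adj x y ≡ true → Walk y z → Walk x z

    vertices : ∀ {x y} → Walk x y → List (Fin n)
    vertices [ x ]          = x ∷ []
    vertices (x ∷⟨ _ ⟩ w)   = x ∷ vertices w

    weight : ∀ {x y} → Walk x y → ℝ
    weight [ x ] = 0r
    weight (_∷⟨_⟩_ {y} x _ w) = φ x y + weight w

    IsPath : ∀ {x y} → Walk x y → Set
    IsPath w = Unique (vertices w)

    -- d(x,y) ≤ t   (d is the minimum weight of a path; ∞ if none)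
    DistLe : Fin n → Fin n → ℝ → Set
    DistLe x y t = Σ (Walk x y) λ w → IsPath w × weight w ≤ t

    DistGe : Fin n → Fin n → ℝ → Set
    DistGe x y t = (w : Walk x y) → IsPath w → t ≤ weight w

    SetDistGe : Pred → Pred → ℝ → Set
    SetDistGe A B t = ∀ u v → A u → B v → DistGe u v t

    Bounded : ℝ → Pred → Set
    Bounded D C = ∀ x y → C x → C y → DistLe x y D

    data RChain (A : Pred) (r : ℝ) : Fin n → Fin n → Set where
      stop : ∀ {x} → A x → RChain A r x x
      step : ∀ {x y z} → A x → DistLe x y r → RChain A r y z → RChain A r x z

    PairwiseRConnected : Pred → ℝ → Pred → Set
    PairwiseRConnected A r C = ∀ x y → C x → C y → RChain A r x y

    IsRComponent : Pred → ℝ → Pred → Set₁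
    IsRComponent A r C =
      (∀ x → C x → A x) × PairwiseRConnected A r C ×
      ((C' : Pred) → (∀ x → C x → C' x) → (∀ x → C' x → A x) →
        PairwiseRConnected A r C' → ∀ x → C' x → C x)

    RComponentsBounded : ℝ → ℝ → Pred → Set₁
    RComponentsBounded r D A = (C : Pred) → IsRComponent A r C → Bounded D C

    onWalk : ∀ {x y} → Walk x y → Pred
    onWalk w v = v ∈ vertices w

    record PathBetween (A B : Pred) : Set where
      field
        start end : Fin n
        start∈A   : A start
        end∈B     : B end
        walk      : Walk start end
        isPath    : IsPath walk

    onPath : ∀ {A B} → PathBetween A B → Pred
    onPath P = onWalk (PathBetween.walk P)

    -- G contains H as a q-fat minor, where H is the simple graph on
    -- Fin m with adjacency HAdj (edges of H are indexed as u < v).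
    record FatMinor (q : ℕ) (m : ℕ) (HAdj : Fin m → Fin m → Bool) : Set₁ where
      field
        T          : Fin m → Pred
        T-disjoint : ∀ u v → u ≢ v → ∀ x → T u x → T v x → ⊥
        T-nonempty : ∀ u → ∃ (T u)
        T-connected : ∀ u x y → T u x → T u y →
                      Σ (Walk x y) λ w → All (T u) (vertices w)
        T-far      : ∀ u v → u ≢ v → SetDistGe (T u) (T v) (fromℕ q)
        P          : ∀ u v → u F.< v → HAdj u v ≡ true → PathBetween (T u) (T v)
        P-far      : ∀ u v x y (uv : u F.< v) (e : HAdj u v ≡ true)
                       (xy : x F.< y) (e' : HAdj x y ≡ true) →
                     ¬ (u ≡ x × v ≡ y) →
                     SetDistGe (onPath (P u v uv e)) (onPath (P x y xy e')) (fromℕ q)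
        P-T-far    : ∀ u v (uv : u F.< v) (e : HAdj u v ≡ true) w →
                     w ≢ u → w ≢ v →
                     SetDistGe (onPath (P u v uv e)) (T w) (fromℕ q)

-- The complete bipartite graph K_{2,p} on Fin (2 + p):
-- vertices 0,1 form one side, vertices 2,…,p+1 the other.

K2-isLeft : ∀ {p} → Fin (2 ℕ.+ p) → Bool
K2-isLeft i = toℕ i ℕ.<ᵇ 2

K2-Adj : ∀ p → Fin (2 ℕ.+ p) → Fin (2 ℕ.+ p) → Bool
K2-Adj p u v = K2-isLeft u xor K2-isLeft v

fatBound : (Rs : RealNumbers) → ℕ → ℕ → RealNumbers.ℝ Rs → RealNumbers.ℝ Rs → RealNumbers.ℝ Rs
fatBound Rs p q r κ = (fromℕ 5 * r + fromℕ 9 * fromℕ q + fromℕ 9 * κ) * fromℕ p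
  where open RealNumbers Rs

-- Take the least vertex o of each component and cut the heights d(o, ·) into layers of width r + q + κ;
-- A and B are the unions of the even and of the odd layers. Two points of one class at distance ≤ r lie in
-- the same layer, so an r-component stays inside one layer of one component. If it contained x and y with
-- d(x, y) > (5r + 9q + 9κ)p, the layer is deep (a shallow one has diameter below that bound), and the r-chain
-- from x to y passes through points x_j with d(x, x_j) ≈ jΔ for j < p, Δ = 5r + 9q + 9κ. Geodesics from the
-- x_j back to o, cut at three levels below the layer, form p columns; the chain, the ball around o below the
-- lowest level and the middle segments of the columns are the branch sets of a q-fat K₂,ₚ. All separations
-- come from gaps between level sets of d(o, ·) or, between different columns, of d(x, ·).

module Submission where

open import Defs
open import Level using (0ℓ)
open import Data.Nat as ℕ using (ℕ; zero; suc)
import Data.Nat.Properties as ℕ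
open import Data.Sum using (_⊎_; inj₁; inj₂; [_,_]′)
open import Data.Product using (Σ; ∃; _×_; _,_; proj₁; proj₂)
open import Data.Fin as F using (Fin; toℕ)
import Data.Fin.Properties as F
open import Data.List as List using (List; []; _∷_)
open import Data.List.Relation.Unary.All as All using (All; []; _∷_)
open import Data.List.Relation.Unary.Any using (here; there)
open import Data.List.Relation.Unary.Unique.Propositional using (Unique; []; _∷_)
open import Data.List.Membership.Propositional using (_∈_)
open import Data.List.Membership.Propositional.Properties using (∈-lookup; ∈-allFin)
open import Data.Maybe using (Maybe; just; nothing)
open import Relation.Nullary using (¬_; Dec; yes; no)
open import Data.Empty using (⊥; ⊥-elim)
open import Data.Bool using (Bool; true; false; not)
open import Relation.Binary.PropositionalEquality
open import Relation.Binary.Definitions using (tri<; tri≈; tri>)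
open import Relation.Binary.Bundles using (StrictPartialOrder)
open import Relation.Binary.Structures using (IsStrictTotalOrder)
open import Algebra.Bundles using (CommutativeRing)
import Relation.Binary.Reasoning.StrictPartialOrder

module OrderedField (Rs : RealNumbers) where
  open RealNumbers Rs public

  commutativeRing : CommutativeRing 0ℓ 0ℓ
  commutativeRing = record { isCommutativeRing = isCommutativeRing }

  open CommutativeRing commutativeRing public
    using (+-assoc; +-comm; +-identityˡ; +-identityʳ; -‿inverseˡ; -‿inverseʳ;
           *-comm; *-identityˡ; distribʳ; zeroˡ; +-commutativeMonoid; ring)
  open import Algebra.Properties.Ring ring using (-‿distribˡ-*; -‿involutive)

  open IsStrictTotalOrder isStrictTotalOrder using (compare; isStrictPartialOrder)
    renaming (trans to <-trans) public

  strictPartialOrder : StrictPartialOrder 0ℓ 0ℓ 0ℓ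
  strictPartialOrder = record { isStrictPartialOrder = isStrictPartialOrder }

  module ≤-Reasoning = Relation.Binary.Reasoning.StrictPartialOrder strictPartialOrder

  <-irrefl : ∀ {x} → x < x → ⊥
  <-irrefl = IsStrictTotalOrder.irrefl isStrictTotalOrder refl

  ≤-refl : ∀ {x} → x ≤ x
  ≤-refl = inj₂ refl

  ≤-reflexive : ∀ {x y} → x ≡ y → x ≤ y
  ≤-reflexive = inj₂

  <⇒≤ : ∀ {x y} → x < y → x ≤ y
  <⇒≤ = inj₁

  <-≤-trans : ∀ {x y z} → x < y → y ≤ z → x < z
  <-≤-trans p (inj₁ q)    = <-trans p q
  <-≤-trans p (inj₂ refl) = p

  ≤-<-trans : ∀ {x y z} → x ≤ y → y < z → x < z
  ≤-<-trans (inj₁ p)    q = <-trans p q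
  ≤-<-trans (inj₂ refl) q = q

  ≤-trans : ∀ {x y z} → x ≤ y → y ≤ z → x ≤ z
  ≤-trans (inj₁ p)    q = inj₁ (<-≤-trans p q)
  ≤-trans (inj₂ refl) q = q

  <⇒≱ : ∀ {x y} → x < y → y ≤ x → ⊥
  <⇒≱ p q = <-irrefl (<-≤-trans p q)

  ≤-antisym : ∀ {x y} → x ≤ y → y ≤ x → x ≡ y
  ≤-antisym (inj₂ p) _ = p
  ≤-antisym (inj₁ p) q = ⊥-elim (<⇒≱ p q)

  ≤-<-connex : ∀ x y → x ≤ y ⊎ y < x
  ≤-<-connex x y with compare x y
  ... | tri< x<y _ _ = inj₁ (inj₁ x<y)
  ... | tri≈ _ x≡y _ = inj₁ (inj₂ x≡y)
  ... | tri> _ _ y<x = inj₂ y<x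

  +-monoˡ-< : ∀ {x y} z → x < y → x + z < y + z
  +-monoˡ-< z p = +-mono-< _ _ z p

  +-monoʳ-< : ∀ {x y} z → x < y → z + x < z + y
  +-monoʳ-< {x} {y} z p = subst₂ _<_ (+-comm x z) (+-comm y z) (+-monoˡ-< z p)

  +-monoˡ-≤ : ∀ {x y} z → x ≤ y → x + z ≤ y + z
  +-monoˡ-≤ z (inj₁ p)    = inj₁ (+-monoˡ-< z p)
  +-monoˡ-≤ z (inj₂ refl) = ≤-refl

  +-monoʳ-≤ : ∀ {x y} z → x ≤ y → z + x ≤ z + y
  +-monoʳ-≤ z (inj₁ p)    = inj₁ (+-monoʳ-< z p)
  +-monoʳ-≤ z (inj₂ refl) = ≤-refl

  +-mono-≤ : ∀ {a b c d} → a ≤ b → c ≤ d → a + c ≤ b + d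
  +-mono-≤ {b = b} {c} p q = ≤-trans (+-monoˡ-≤ c p) (+-monoʳ-≤ b q)

  +-mono-<-≤ : ∀ {a b c d} → a < b → c ≤ d → a + c < b + d
  +-mono-<-≤ {b = b} {c} p q = <-≤-trans (+-monoˡ-< c p) (+-monoʳ-≤ b q)

  x+z-z≡x : ∀ x z → (x + z) + - z ≡ x
  x+z-z≡x x z = trans (+-assoc x z (- z)) (trans (cong (x +_) (-‿inverseʳ z)) (+-identityʳ x))

  x-z+z≡x : ∀ x z → (x + - z) + z ≡ x
  x-z+z≡x x z = trans (+-assoc x (- z) z) (trans (cong (x +_) (-‿inverseˡ z)) (+-identityʳ x))

  +-cancelʳ-≤ : ∀ {x y} z → x + z ≤ y + z → x ≤ y
  +-cancelʳ-≤ {x} {y} z p = subst₂ _≤_ (x+z-z≡x x z) (x+z-z≡x y z) (+-monoˡ-≤ (- z) p)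

  +-cancelˡ-≤ : ∀ {x y} z → z + x ≤ z + y → x ≤ y
  +-cancelˡ-≤ {x} {y} z p = +-cancelʳ-≤ z (subst₂ _≤_ (+-comm z x) (+-comm z y) p)

  x≤x+y : ∀ x {y} → 0r ≤ y → x ≤ x + y
  x≤x+y x p = subst (_≤ x + _) (+-identityʳ x) (+-monoʳ-≤ x p)

  x≤y+x : ∀ x {y} → 0r ≤ y → x ≤ y + x
  x≤y+x x {y} p = subst (x ≤_) (+-comm x y) (x≤x+y x p)

  x<x+y : ∀ x {y} → 0r < y → x < x + y
  x<x+y x p = subst (_< x + _) (+-identityʳ x) (+-monoʳ-< x p)

  ≤-by : ∀ {x y} d → x + d ≡ y → 0r ≤ d → x ≤ y
  ≤-by {x} d eq p = subst (x ≤_) eq (x≤x+y x p)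

  +-nonNeg : ∀ {x y} → 0r ≤ x → 0r ≤ y → 0r ≤ x + y
  +-nonNeg {x} p q = ≤-trans p (x≤x+y x q)

  0<1 : 0r < 1r
  0<1 with compare 0r 1r
  ... | tri< 0<1 _ _ = 0<1
  ... | tri≈ _ 0≡1 _ = ⊥-elim (0≢1 0≡1)
  ... | tri> _ _ 1<0 = ⊥-elim (<-irrefl (<-trans 1<0 square-of-minus-one-pos))
    where
    0<-1 : 0r < - 1r
    0<-1 = subst₂ _<_ (trans (+-comm 1r (- 1r)) (-‿inverseˡ 1r)) (+-identityˡ (- 1r)) (+-monoˡ-< (- 1r) 1<0)
    square-of-minus-one-pos : 0r < 1r
    square-of-minus-one-pos = subst (0r <_)
      (trans (sym (-‿distribˡ-* 1r (- 1r))) (trans (cong -_ (*-identityˡ (- 1r))) (-‿involutive 1r)))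
      (*-pos (- 1r) (- 1r) 0<-1 0<-1)

  0≤fromℕ : ∀ k → 0r ≤ fromℕ k
  0≤fromℕ zero    = ≤-refl
  0≤fromℕ (suc k) = +-nonNeg (<⇒≤ 0<1) (0≤fromℕ k)

  0<fromℕ : ∀ {k} → 1 ℕ.≤ k → 0r < fromℕ k
  0<fromℕ {suc k} _ = <-≤-trans 0<1 (x≤x+y 1r (0≤fromℕ k))

  fromℕ-suc-* : ∀ k x → fromℕ (suc k) * x ≡ x + fromℕ k * x
  fromℕ-suc-* k x = trans (distribʳ x 1r (fromℕ k)) (cong (_+ fromℕ k * x) (*-identityˡ x))

  *-nonNeg : ∀ k {x} → 0r ≤ x → 0r ≤ fromℕ k * x
  *-nonNeg zero    {x} p = ≤-reflexive (sym (zeroˡ x))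
  *-nonNeg (suc k) {x} p = subst (0r ≤_) (sym (fromℕ-suc-* k x)) (+-nonNeg p (*-nonNeg k p))

  *-monoˡ-≤ : ∀ {a b} x → a ℕ.≤ b → 0r ≤ x → fromℕ a * x ≤ fromℕ b * x
  *-monoˡ-≤ {zero}  {b}     x _           p = subst (_≤ fromℕ b * x) (sym (zeroˡ x)) (*-nonNeg b p)
  *-monoˡ-≤ {suc a} {suc b} x (ℕ.s≤s a≤b) p =
    subst₂ _≤_ (sym (fromℕ-suc-* a x)) (sym (fromℕ-suc-* b x)) (+-monoʳ-≤ x (*-monoˡ-≤ x a≤b p))

  *-monoʳ-≤ : ∀ k {x y} → x ≤ y → fromℕ k * x ≤ fromℕ k * y
  *-monoʳ-≤ zero    {x} {y} _   = ≤-reflexive (trans (zeroˡ x) (sym (zeroˡ y)))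
  *-monoʳ-≤ (suc k) {x} {y} x≤y =
    subst₂ _≤_ (sym (fromℕ-suc-* k x)) (sym (fromℕ-suc-* k y)) (+-mono-≤ x≤y (*-monoʳ-≤ k x≤y))

  record Floor (w t : ℝ) : Set where
    field
      k     : ℕ
      lower : fromℕ k * w ≤ t
      upper : t < fromℕ (suc k) * w

  floor : ∀ {w t} N → 0r ≤ t → t < fromℕ N * w → Floor w t
  floor {w} {t} zero    0≤t t<0 = ⊥-elim (<⇒≱ t<0 (subst (_≤ t) (sym (zeroˡ w)) 0≤t))
  floor {w} {t} (suc N) 0≤t t<N+1 with ≤-<-connex (fromℕ N * w) t
  ... | inj₁ Nw≤t = record { k = N ; lower = Nw≤t ; upper = t<N+1 }
  ... | inj₂ t<Nw = floor N 0≤t t<Nw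

  -- Multiples k · x as iterated sums, so that the commutative-monoid solver can see them.
  _×ᵣ_ : ℕ → ℝ → ℝ
  zero  ×ᵣ x = 0r
  suc k ×ᵣ x = x + k ×ᵣ x

  fromℕ-*≡×ᵣ : ∀ k x → fromℕ k * x ≡ k ×ᵣ x
  fromℕ-*≡×ᵣ zero    x = zeroˡ x
  fromℕ-*≡×ᵣ (suc k) x = trans (fromℕ-suc-* k x) (cong (x +_) (fromℕ-*≡×ᵣ k x))

  ×ᵣ-nonNeg : ∀ k {x} → 0r ≤ x → 0r ≤ k ×ᵣ x
  ×ᵣ-nonNeg k {x} p = subst (0r ≤_) (fromℕ-*≡×ᵣ k x) (*-nonNeg k p)

  open import Algebra.Solver.CommutativeMonoid +-commutativeMonoid public
    using (solve; _⊕_; _⊜_; Expr) renaming (id to ε⊕)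

  _×⊕_ : ∀ {m} → ℕ → Expr m → Expr m
  zero  ×⊕ e = ε⊕
  suc k ×⊕ e = e ⊕ k ×⊕ e

module Walks (Rs : RealNumbers) (G : WithReals.WGraph Rs) where
  open OrderedField Rs
  open WithReals Rs
  open WGraph G
  open import Data.List.Membership.DecPropositional (F._≟_ {n}) using (_∈?_)

  Vertex : Set
  Vertex = Fin n

  infixr 5 _++ʷ_
  _++ʷ_ : ∀ {x y z} → Walk G x y → Walk G y z → Walk G x z
  [ x ]          ++ʷ w′ = w′
  (x ∷⟨ e ⟩ w) ++ʷ w′ = x ∷⟨ e ⟩ (w ++ʷ w′)

  weight-++ : ∀ {x y z} (w : Walk G x y) (w′ : Walk G y z) → weight G (w ++ʷ w′) ≡ weight G w + weight G w′
  weight-++ [ x ]                  w′ = sym (+-identityˡ _)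
  weight-++ (_∷⟨_⟩_ {y} x e w) w′ = trans (cong (φ x y +_) (weight-++ w w′)) (sym (+-assoc _ _ _))

  ++ʷ-assoc : ∀ {x y z t} (w₁ : Walk G x y) (w₂ : Walk G y z) (w₃ : Walk G z t) →
              (w₁ ++ʷ w₂) ++ʷ w₃ ≡ w₁ ++ʷ (w₂ ++ʷ w₃)
  ++ʷ-assoc [ x ]          w₂ w₃ = refl
  ++ʷ-assoc (x ∷⟨ e ⟩ w₁) w₂ w₃ = cong (x ∷⟨ e ⟩_) (++ʷ-assoc w₁ w₂ w₃)

  weight-nonNeg : ∀ {x y} (w : Walk G x y) → 0r ≤ weight G w
  weight-nonNeg [ x ]                  = ≤-refl
  weight-nonNeg (_∷⟨_⟩_ {y} x e w) = +-nonNeg (<⇒≤ (φ-pos x y e)) (weight-nonNeg w)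

  ∈-start : ∀ {x y} (w : Walk G x y) → x ∈ vertices G w
  ∈-start [ x ]        = here refl
  ∈-start (x ∷⟨ e ⟩ w) = here refl

  ∈-end : ∀ {x y} (w : Walk G x y) → y ∈ vertices G w
  ∈-end [ x ]        = here refl
  ∈-end (x ∷⟨ e ⟩ w) = there (∈-end w)

  ∈-++⁺ˡ : ∀ {x y z u} (w : Walk G x y) (w′ : Walk G y z) → u ∈ vertices G w → u ∈ vertices G (w ++ʷ w′)
  ∈-++⁺ˡ [ x ]        w′ (here refl) = ∈-start w′
  ∈-++⁺ˡ (x ∷⟨ e ⟩ w) w′ (here u≡x)  = here u≡x
  ∈-++⁺ˡ (x ∷⟨ e ⟩ w) w′ (there u∈w) = there (∈-++⁺ˡ w w′ u∈w)

  ∈-++⁺ʳ : ∀ {x y z u} (w : Walk G x y) (w′ : Walk G y z) → u ∈ vertices G w′ → u ∈ vertices G (w ++ʷ w′)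
  ∈-++⁺ʳ [ x ]        w′ u∈w′ = u∈w′
  ∈-++⁺ʳ (x ∷⟨ e ⟩ w) w′ u∈w′ = there (∈-++⁺ʳ w w′ u∈w′)

  ∈-++⁻ : ∀ {x y z u} (w : Walk G x y) (w′ : Walk G y z) →
          u ∈ vertices G (w ++ʷ w′) → u ∈ vertices G w ⊎ u ∈ vertices G w′
  ∈-++⁻ [ x ]        w′ u∈ = inj₂ u∈
  ∈-++⁻ (x ∷⟨ e ⟩ w) w′ (here u≡x) = inj₁ (here u≡x)
  ∈-++⁻ (x ∷⟨ e ⟩ w) w′ (there u∈) with ∈-++⁻ w w′ u∈
  ... | inj₁ u∈w  = inj₁ (there u∈w)
  ... | inj₂ u∈w′ = inj₂ u∈w′

  record SplitAt {x y} (w : Walk G x y) (u : Vertex) : Set where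
    constructor splitAt
    field
      prefix : Walk G x u
      suffix : Walk G u y
      w≡     : w ≡ prefix ++ʷ suffix

  split : ∀ {x y u} (w : Walk G x y) → u ∈ vertices G w → SplitAt w u
  split [ x ]        (here refl) = splitAt [ x ] [ x ] refl
  split (x ∷⟨ e ⟩ w) (here refl) = splitAt [ x ] (x ∷⟨ e ⟩ w) refl
  split (x ∷⟨ e ⟩ w) (there u∈w) with split w u∈w
  ... | splitAt w₁ w₂ refl = splitAt (x ∷⟨ e ⟩ w₁) w₂ refl

  prefix : ∀ {x y u} (w : Walk G x y) → u ∈ vertices G w → Walk G x u
  prefix w u∈w = SplitAt.prefix (split w u∈w)

  weight-prefix≤ : ∀ {x y u} (w : Walk G x y) (u∈w : u ∈ vertices G w) → weight G (prefix w u∈w) ≤ weight G w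
  weight-prefix≤ w u∈w with split w u∈w
  ... | splitAt w₁ w₂ refl = ≤-trans (x≤x+y _ (weight-nonNeg w₂)) (≤-reflexive (sym (weight-++ w₁ w₂)))

  edge : ∀ {x y} → Adj x y ≡ true → Walk G x y
  edge {x} {y} e = x ∷⟨ e ⟩ [ y ]

  weight-edge : ∀ {x y} (e : Adj x y ≡ true) → weight G (edge e) ≡ φ x y
  weight-edge e = +-identityʳ _

  reverse : ∀ {x y} → Walk G x y → Walk G y x
  reverse [ x ]                  = [ x ]
  reverse (_∷⟨_⟩_ {y} x e w) = reverse w ++ʷ edge (trans (Adj-sym y x) e)

  weight-reverse : ∀ {x y} (w : Walk G x y) → weight G (reverse w) ≡ weight G w
  weight-reverse [ x ] = refl
  weight-reverse (_∷⟨_⟩_ {y} x e w) = begin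
    weight G (reverse w ++ʷ edge e′)    ≡⟨ weight-++ (reverse w) (edge e′) ⟩
    weight G (reverse w) + weight G (edge e′)
      ≡⟨ cong₂ _+_ (weight-reverse w) (trans (weight-edge e′) (φ-sym y x)) ⟩
    weight G w + φ x y                  ≡⟨ +-comm _ _ ⟩
    φ x y + weight G w                  ∎
    where
    open ≡-Reasoning
    e′ = trans (Adj-sym y x) e

  ∈-reverse⁻ : ∀ {x y u} (w : Walk G x y) → u ∈ vertices G (reverse w) → u ∈ vertices G w
  ∈-reverse⁻ [ x ] u∈ = u∈
  ∈-reverse⁻ (_∷⟨_⟩_ {y} x e w) u∈ with ∈-++⁻ (reverse w) (edge (trans (Adj-sym y x) e)) u∈
  ... | inj₁ u∈rw                = there (∈-reverse⁻ w u∈rw)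
  ... | inj₂ (here refl)         = there (∈-start w)
  ... | inj₂ (there (here refl)) = here refl

  connected-within : ∀ {a b u v} (w : Walk G a b) → u ∈ vertices G w → v ∈ vertices G w →
                     Σ (Walk G u v) λ w′ → All (λ z → z ∈ vertices G w) (vertices G w′)
  connected-within w u∈w v∈w with split w u∈w | split w v∈w
  ... | splitAt _ wu refl | splitAt w₁ wv eq =
    wu ++ʷ reverse wv , All.tabulate λ z∈ → [ ∈-++⁺ʳ _ wu , (λ z∈r → inside (∈-reverse⁻ wv z∈r)) ]′ (∈-++⁻ wu (reverse wv) z∈)
    where
    inside : ∀ {z} → z ∈ vertices G wv → z ∈ vertices G _
    inside z∈ = subst (λ w → _ ∈ vertices G w) (sym eq) (∈-++⁺ʳ w₁ wv z∈)

  record Shortcut {x y} (w : Walk G x y) : Set where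
    field
      path    : Walk G x y
      isPath  : IsPath G path
      weight≤ : weight G path ≤ weight G w
      ⊆walk   : ∀ {u} → u ∈ vertices G path → u ∈ vertices G w

  shortcut : ∀ {x y} (w : Walk G x y) → Shortcut w
  shortcut [ x ] = record { path = [ x ] ; isPath = [] ∷ [] ; weight≤ = ≤-refl ; ⊆walk = λ u∈ → u∈ }
  shortcut (_∷⟨_⟩_ {y} x e w) with shortcut w
  ... | record { path = p ; isPath = p! ; weight≤ = p≤w ; ⊆walk = p⊆w } with x ∈? vertices G p
  ...   | no x∉p = record
    { path    = x ∷⟨ e ⟩ p
    ; isPath  = All.tabulate (λ u∈p x≡u → x∉p (subst (_∈ vertices G p) (sym x≡u) u∈p)) ∷ p!
    ; weight≤ = +-monoʳ-≤ (φ x y) p≤w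
    ; ⊆walk   = λ { (here u≡x) → here u≡x ; (there u∈p) → there (p⊆w u∈p) }
    }
  ...   | yes x∈p with split p x∈p
  ...     | splitAt p₁ p₂ refl = record
    { path    = p₂
    ; isPath  = Unique-suffix p₁ p₂ p!
    ; weight≤ = begin
        weight G p₂                          ≤⟨ x≤y+x _ (weight-nonNeg p₁) ⟩
        weight G p₁ + weight G p₂            ≡⟨ weight-++ p₁ p₂ ⟨
        weight G (p₁ ++ʷ p₂)                 ≤⟨ p≤w ⟩
        weight G w                           ≤⟨ x≤y+x _ (<⇒≤ (φ-pos x y e)) ⟩
        φ x y + weight G w                   ∎
    ; ⊆walk   = λ u∈p₂ → there (p⊆w (∈-++⁺ʳ p₁ p₂ u∈p₂))
    }
    where
    open ≤-Reasoning
    Unique-suffix : ∀ {a b c} (w₁ : Walk G a b) (w₂ : Walk G b c) → Unique (vertices G (w₁ ++ʷ w₂)) → Unique (vertices G w₂)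
    Unique-suffix [ _ ]         w₂ u      = u
    Unique-suffix (_ ∷⟨ _ ⟩ w₁) w₂ (_ ∷ u) = Unique-suffix w₁ w₂ u

  length : ∀ {x y} → Walk G x y → ℕ
  length [ x ]        = 0
  length (x ∷⟨ e ⟩ w) = suc (length w)

  weight≤length*κ : ∀ {κ} → Weighted0κ G κ → ∀ {x y} (w : Walk G x y) → weight G w ≤ fromℕ (length w) * κ
  weight≤length*κ {κ} wκ [ x ] = ≤-reflexive (sym (zeroˡ κ))
  weight≤length*κ {κ} wκ (_∷⟨_⟩_ {y} x e w) =
    subst (φ x y + weight G w ≤_) (sym (fromℕ-suc-* (length w) κ)) (+-mono-≤ (wκ x y e) (weight≤length*κ wκ w))

  -- a path visits each of the n vertices at most once
  length-path<n : ∀ {x y} (p : Walk G x y) → IsPath G p → length p ℕ.< n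
  length-path<n p p! = subst (ℕ._≤ n) (length-vertices p) (F.injective⇒≤ (lookup-injective (vertices G p) p!))
    where
    length-vertices : ∀ {x y} (w : Walk G x y) → List.length (vertices G w) ≡ suc (length w)
    length-vertices [ x ]        = refl
    length-vertices (x ∷⟨ e ⟩ w) = cong suc (length-vertices w)
    lookup-injective : ∀ (xs : List Vertex) → Unique xs → ∀ {i j} → List.lookup xs i ≡ List.lookup xs j → i ≡ j
    lookup-injective (x ∷ xs) (x∉ ∷ xs!) {F.zero}  {F.zero}  eq = refl
    lookup-injective (x ∷ xs) (x∉ ∷ xs!) {F.zero}  {F.suc j} eq = ⊥-elim (All.lookup x∉ (∈-lookup j) eq)
    lookup-injective (x ∷ xs) (x∉ ∷ xs!) {F.suc i} {F.zero}  eq = ⊥-elim (All.lookup x∉ (∈-lookup i) (sym eq))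
    lookup-injective (x ∷ xs) (x∉ ∷ xs!) {F.suc i} {F.suc j} eq = cong F.suc (lookup-injective xs xs! eq)

parity : ℕ → Bool
parity zero    = true
parity (suc k) = not (parity k)

parity-gap : ∀ {a b} → parity a ≡ parity b → a ℕ.< b → suc a ℕ.< b
parity-gap {a} eq a<b with ℕ.m≤n⇒m<n∨m≡n a<b
... | inj₁ 1+a<b = 1+a<b
... | inj₂ refl  = ⊥-elim (not-¬ refl eq)
  where open import Data.Bool.Properties using (not-¬)

≢⇒<⊎> : ∀ {m} {i j : Fin m} → i ≢ j → i F.< j ⊎ j F.< i
≢⇒<⊎> {i = i} {j} i≢j with F.<-cmp i j
... | tri< i<j _ _ = inj₁ i<j
... | tri≈ _ i≡j _ = ⊥-elim (i≢j i≡j)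
... | tri> _ _ j<i = inj₂ j<i

least-witness : ∀ {m} {P : Fin m → Set} → (∀ i → Dec (P i)) → ∃ P → Σ (Fin m) λ i → P i × (∀ j → j F.< i → ¬ P j)
least-witness {suc m} P? (i , Pi) with P? F.zero
... | yes P0 = F.zero , P0 , λ _ ()
... | no ¬P0 with i
...   | F.zero   = ⊥-elim (¬P0 Pi)
...   | F.suc i′ with least-witness (λ j → P? (F.suc j)) (i′ , Pi)
...     | k , Pk , below = F.suc k , Pk , λ { F.zero _ → ¬P0 ; (F.suc j) (ℕ.s≤s j<k) → below j j<k }

-- Shortest-path distances by the Bellman–Ford recursion; `distance s v` is 0 when v is unreachable from s.
module Distances (Rs : RealNumbers) (G : WithReals.WGraph Rs) where
  open OrderedField Rs
  open WithReals Rs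
  open WGraph G
  open Walks Rs G

  _⊓ᵐ_ : Maybe ℝ → Maybe ℝ → Maybe ℝ
  nothing ⊓ᵐ m       = m
  just a  ⊓ᵐ nothing = just a
  just a  ⊓ᵐ just b  = just (choose (≤-<-connex a b))
    where
    choose : a ≤ b ⊎ b < a → ℝ
    choose (inj₁ _) = a
    choose (inj₂ _) = b

  _≤ᵐ_ : Maybe ℝ → ℝ → Set
  m ≤ᵐ t = Σ ℝ λ d → m ≡ just d × d ≤ t

  ⊓ᵐ-≤ᵐˡ : ∀ m m′ {t} → m ≤ᵐ t → (m ⊓ᵐ m′) ≤ᵐ t
  ⊓ᵐ-≤ᵐˡ (just a) nothing  m≤t = m≤t
  ⊓ᵐ-≤ᵐˡ (just a) (just b) (_ , refl , a≤t) with ≤-<-connex a b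
  ... | inj₁ _   = a , refl , a≤t
  ... | inj₂ b<a = b , refl , ≤-trans (<⇒≤ b<a) a≤t

  ⊓ᵐ-≤ᵐʳ : ∀ m m′ {t} → m′ ≤ᵐ t → (m ⊓ᵐ m′) ≤ᵐ t
  ⊓ᵐ-≤ᵐʳ nothing  m′       m′≤t = m′≤t
  ⊓ᵐ-≤ᵐʳ (just a) (just b) (_ , refl , b≤t) with ≤-<-connex a b
  ... | inj₁ a≤b = a , refl , ≤-trans a≤b b≤t
  ... | inj₂ _   = b , refl , b≤t

  ⊓ᵐ-sel : ∀ m m′ {d} → m ⊓ᵐ m′ ≡ just d → m ≡ just d ⊎ m′ ≡ just d
  ⊓ᵐ-sel nothing  m′       eq = inj₂ eq
  ⊓ᵐ-sel (just a) nothing  eq = inj₁ eq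
  ⊓ᵐ-sel (just a) (just b) eq with ≤-<-connex a b
  ... | inj₁ _ = inj₁ eq
  ... | inj₂ _ = inj₂ eq

  shortest : ℕ → Vertex → Vertex → Maybe ℝ
  viaNeighbour : ℕ → Vertex → Vertex → List Vertex → Maybe ℝ

  shortest zero x y with x F.≟ y
  ... | yes _ = just 0r
  ... | no _  = nothing
  shortest (suc k) x y = shortest k x y ⊓ᵐ viaNeighbour k x y (List.allFin n)

  viaNeighbour k x y []       = nothing
  viaNeighbour k x y (z ∷ zs) = throughEdge (Adj x z) (shortest k z y) ⊓ᵐ viaNeighbour k x y zs
    where
    throughEdge : Bool → Maybe ℝ → Maybe ℝ
    throughEdge true (just d) = just (φ x z + d)
    throughEdge _    _        = nothing

  record Realised (k : ℕ) (x y : Vertex) (d : ℝ) : Set where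
    constructor realised
    field
      walk    : Walk G x y
      weight≡ : weight G walk ≡ d
      length≤ : length walk ℕ.≤ k

  shortest-sound : ∀ k x y {d} → shortest k x y ≡ just d → Realised k x y d
  shortest-sound zero x y eq with x F.≟ y
  shortest-sound zero x .x refl | yes refl = realised [ x ] refl ℕ.z≤n
  shortest-sound (suc k) x y eq with ⊓ᵐ-sel (shortest k x y) (viaNeighbour k x y (List.allFin n)) eq
  ... | inj₁ eq′ with shortest-sound k x y eq′
  ...   | realised w w≡ w≤k = realised w w≡ (ℕ.m≤n⇒m≤1+n w≤k)
  shortest-sound (suc k) x y eq | inj₂ eq′ = viaNeighbour-sound (List.allFin n) eq′
    where
    viaNeighbour-sound : ∀ zs {d} → viaNeighbour k x y zs ≡ just d → Realised (suc k) x y d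
    viaNeighbour-sound (z ∷ zs) eq with ⊓ᵐ-sel _ (viaNeighbour k x y zs) eq
    ... | inj₂ eq′ = viaNeighbour-sound zs eq′
    ... | inj₁ eq′ with Adj x z in xz | shortest k z y in dz
    ...   | true | just d with eq′
    ...     | refl with shortest-sound k z y dz
    ...       | realised w refl w≤k = realised (x ∷⟨ xz ⟩ w) refl (ℕ.s≤s w≤k)

  shortest-complete : ∀ k {x y} (w : Walk G x y) → length w ℕ.≤ k → shortest k x y ≤ᵐ weight G w
  shortest-complete zero [ x ] _ with x F.≟ x
  ... | yes _  = 0r , refl , ≤-refl
  ... | no x≢x = ⊥-elim (x≢x refl)
  shortest-complete (suc k) {x} [ .x ] _ =
    ⊓ᵐ-≤ᵐˡ (shortest k x x) _ (shortest-complete k [ x ] ℕ.z≤n)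
  shortest-complete (suc k) {x} {y} (_∷⟨_⟩_ {z} .x xz w) (ℕ.s≤s w≤k) =
    ⊓ᵐ-≤ᵐʳ (shortest k x y) _ (viaNeighbour-complete (List.allFin n) (∈-allFin z))
    where
    viaNeighbour-complete : ∀ zs → z ∈ zs → viaNeighbour k x y zs ≤ᵐ (φ x z + weight G w)
    viaNeighbour-complete (.z ∷ zs) (here refl) with Adj x z | shortest k z y | shortest-complete k w w≤k
    ... | true | .(just d) | d , refl , d≤w =
      ⊓ᵐ-≤ᵐˡ (just (φ x z + d)) (viaNeighbour k x y zs) (_ , refl , +-monoʳ-≤ (φ x z) d≤w)
    viaNeighbour-complete (z′ ∷ zs) (there z∈zs) = ⊓ᵐ-≤ᵐʳ _ (viaNeighbour k x y zs) (viaNeighbour-complete zs z∈zs)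

  distance : Vertex → Vertex → ℝ
  distance s v with shortest n s v
  ... | just d  = d
  ... | nothing = 0r

  shortest-reachable : ∀ {s v} (w : Walk G s v) → shortest n s v ≤ᵐ weight G w
  shortest-reachable w with shortest-complete n (Shortcut.path sc) (ℕ.<⇒≤ (length-path<n _ (Shortcut.isPath sc)))
    where sc = shortcut w
  ... | d , eq , d≤p = d , eq , ≤-trans d≤p (Shortcut.weight≤ (shortcut w))

  distance≤weight : ∀ {s v} (w : Walk G s v) → distance s v ≤ weight G w
  distance≤weight {s} {v} w with shortest n s v | shortest-reachable w
  ... | .(just d) | d , refl , d≤w = d≤w

  distance-realised : ∀ {s v} → Walk G s v → Realised n s v (distance s v)
  distance-realised {s} {v} w with shortest n s v in eq | shortest-reachable w
  ... | just d  | _          = shortest-sound n s v eq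
  ... | nothing | _ , () , _

  record Geodesic (s v : Vertex) : Set where
    field
      path    : Walk G s v
      isPath  : IsPath G path
      weight≡ : weight G path ≡ distance s v

  geodesic : ∀ {s v} → Walk G s v → Geodesic s v
  geodesic w = record
    { path = Shortcut.path sc ; isPath = Shortcut.isPath sc
    ; weight≡ = ≤-antisym (≤-trans (Shortcut.weight≤ sc) (≤-reflexive (Realised.weight≡ r))) (distance≤weight (Shortcut.path sc)) }
    where
    r  = distance-realised w
    sc = shortcut (Realised.walk r)

  distance-nonNeg : ∀ s v → 0r ≤ distance s v
  distance-nonNeg s v with shortest n s v in eq
  ... | just d  = subst (0r ≤_) (Realised.weight≡ r) (weight-nonNeg (Realised.walk r))
    where r = shortest-sound n s v eq
  ... | nothing = ≤-refl

  distance≤nκ : ∀ {κ} → Weighted0κ G κ → 0r ≤ κ → ∀ s v → distance s v ≤ fromℕ n * κ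
  distance≤nκ {κ} wκ 0≤κ s v with shortest n s v in eq
  ... | nothing = *-nonNeg n 0≤κ
  ... | just d with shortest-sound n s v eq
  ...   | realised w refl w≤n = ≤-trans (weight≤length*κ wκ w) (*-monoˡ-≤ κ w≤n 0≤κ)

  distance-self : ∀ s → distance s s ≡ 0r
  distance-self s = ≤-antisym (distance≤weight [ s ]) (distance-nonNeg s s)

  distance-triangle : ∀ {s a b} → Walk G s a → (w : Walk G a b) → distance s b ≤ distance s a + weight G w
  distance-triangle sa w = begin
    distance _ _                       ≤⟨ distance≤weight (Geodesic.path γ ++ʷ w) ⟩
    weight G (Geodesic.path γ ++ʷ w)   ≡⟨ weight-++ (Geodesic.path γ) w ⟩
    weight G (Geodesic.path γ) + weight G w ≡⟨ cong (_+ weight G w) (Geodesic.weight≡ γ) ⟩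
    distance _ _ + weight G w          ∎
    where
    open ≤-Reasoning
    γ = geodesic sa

  distance-triangle′ : ∀ {s a b} → Walk G s a → (w : Walk G a b) → distance s a ≤ distance s b + weight G w
  distance-triangle′ {s} {b = b} sa w =
    subst (λ t → distance s _ ≤ distance s b + t) (weight-reverse w) (distance-triangle (sa ++ʷ w) (reverse w))

  geodesic-below : ∀ {s v} (γ : Geodesic s v) {z} → z ∈ vertices G (Geodesic.path γ) → distance s z ≤ distance s v
  geodesic-below γ z∈ = ≤-trans (distance≤weight (prefix (Geodesic.path γ) z∈))
                          (≤-trans (weight-prefix≤ (Geodesic.path γ) z∈) (≤-reflexive (Geodesic.weight≡ γ)))

  distance-via : ∀ {s a b} → Walk G s a → Walk G s b → distance a b ≤ distance s a + distance s b
  distance-via sa sb = begin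
    distance _ _                                        ≤⟨ distance≤weight (reverse (Geodesic.path γa) ++ʷ Geodesic.path γb) ⟩
    weight G (reverse (Geodesic.path γa) ++ʷ Geodesic.path γb) ≡⟨ weight-++ (reverse (Geodesic.path γa)) _ ⟩
    weight G (reverse (Geodesic.path γa)) + weight G (Geodesic.path γb)
      ≡⟨ cong₂ _+_ (trans (weight-reverse (Geodesic.path γa)) (Geodesic.weight≡ γa)) (Geodesic.weight≡ γb) ⟩
    distance _ _ + distance _ _                         ∎
    where
    open ≤-Reasoning
    γa = geodesic sa
    γb = geodesic sb

  distance-attained-or-exceeds : ∀ {s v} → Walk G s v → ∀ t → DistLe G s v t ⊎ t < distance s v
  distance-attained-or-exceeds w t with ≤-<-connex (distance _ _) t
  ... | inj₂ t<d = inj₂ t<d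
  ... | inj₁ d≤t = inj₁ (Geodesic.path γ , Geodesic.isPath γ , subst (_≤ t) (sym (Geodesic.weight≡ γ)) d≤t)
    where γ = geodesic w

  -- A walk across a gap of width q between level sets of distance s has weight ≥ q,
  -- because distance s is 1-Lipschitz along walks.
  across-levels : ∀ s {u v a b c q} → Walk G s u → distance s u ≤ a → b ≤ distance s v + c → q + a + c ≤ b →
                  (w : Walk G u v) → q ≤ weight G w
  across-levels s {u} {v} {a} {b} {c} {q} su u≤a b≤v+c gap w = +-cancelʳ-≤ (a + c) (begin
    q + (a + c)                     ≡⟨ +-assoc q a c ⟨
    q + a + c                       ≤⟨ gap ⟩
    b                               ≤⟨ b≤v+c ⟩
    distance s v + c                ≤⟨ +-monoˡ-≤ c (distance-triangle su w) ⟩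
    distance s u + weight G w + c   ≤⟨ +-monoˡ-≤ c (+-monoˡ-≤ (weight G w) u≤a) ⟩
    a + weight G w + c              ≡⟨ solve 3 (λ a w c → (a ⊕ w) ⊕ c ⊜ w ⊕ (a ⊕ c)) refl a (weight G w) c ⟩
    weight G w + (a + c)            ∎)
    where open ≤-Reasoning

  levels-far : ∀ s (X Y : Pred G) {a b c q} → (∀ u → X u → Walk G s u) →
               (∀ u → X u → distance s u ≤ a) → (∀ v → Y v → b ≤ distance s v + c) → q + a + c ≤ b →
               SetDistGe G X Y q
  levels-far s X Y reachX below above gap u v Xu Yv w _ =
    across-levels s (reachX u Xu) (below u Xu) (above v Yv) gap w

  levels-far′ : ∀ s (X Y : Pred G) {a b c q} → (∀ v → Y v → Walk G s v) →
                (∀ u → X u → distance s u ≤ a) → (∀ v → Y v → b ≤ distance s v + c) → q + a + c ≤ b →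
                SetDistGe G Y X q
  levels-far′ s X Y reachY below above gap v u Yv Xu w _ =
    subst (_ ≤_) (weight-reverse w) (across-levels s (reachY v Yv ++ʷ w) (below u Xu) (above v Yv) gap (reverse w))

  -- Walks along which distance from o drops by exactly their weight (reversed geodesics).
  module Descending (o : Vertex) where
    H : Vertex → ℝ
    H = distance o

    Descends : ∀ {a b} → Walk G a b → Set
    Descends {a} {b} w = H b + weight G w ≤ H a

    descends-prefix : ∀ {a c b} → Walk G o a → (w₁ : Walk G a c) (w₂ : Walk G c b) →
                      Descends (w₁ ++ʷ w₂) → Descends w₁
    descends-prefix {a} {c} {b} oa w₁ w₂ d = begin
      H c + weight G w₁                      ≤⟨ +-monoˡ-≤ (weight G w₁) (distance-triangle′ (oa ++ʷ w₁) w₂) ⟩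
      H b + weight G w₂ + weight G w₁        ≡⟨ solve 3 (λ h x y → (h ⊕ y) ⊕ x ⊜ h ⊕ (x ⊕ y)) refl (H b) (weight G w₁) (weight G w₂) ⟩
      H b + (weight G w₁ + weight G w₂)      ≡⟨ cong (H b +_) (weight-++ w₁ w₂) ⟨
      H b + weight G (w₁ ++ʷ w₂)             ≤⟨ d ⟩
      H a                                    ∎
      where open ≤-Reasoning

    descends-suffix : ∀ {a c b} → Walk G o a → (w₁ : Walk G a c) (w₂ : Walk G c b) →
                      Descends (w₁ ++ʷ w₂) → Descends w₂
    descends-suffix {a} {c} {b} oa w₁ w₂ d = +-cancelʳ-≤ (weight G w₁) (begin
      H b + weight G w₂ + weight G w₁        ≡⟨ solve 3 (λ h x y → (h ⊕ y) ⊕ x ⊜ h ⊕ (x ⊕ y)) refl (H b) (weight G w₁) (weight G w₂) ⟩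
      H b + (weight G w₁ + weight G w₂)      ≡⟨ cong (H b +_) (weight-++ w₁ w₂) ⟨
      H b + weight G (w₁ ++ʷ w₂)             ≤⟨ d ⟩
      H a                                    ≤⟨ distance-triangle′ oa w₁ ⟩
      H c + weight G w₁                      ∎)
      where open ≤-Reasoning

    descends-between : ∀ {a b u} → Walk G o a → (w : Walk G a b) → Descends w → u ∈ vertices G w →
                       H b ≤ H u × H u ≤ H a
    descends-between oa w d u∈w with split w u∈w
    ... | splitAt w₁ w₂ refl =
      ≤-trans (x≤x+y _ (weight-nonNeg w₂)) (descends-suffix oa w₁ w₂ d) ,
      ≤-trans (x≤x+y _ (weight-nonNeg w₁)) (descends-prefix oa w₁ w₂ d)

    -- the first vertex at which a descending walk gets down to level t; edges of weight ≤ κ overshoot by ≤ κ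
    record Crossing {a b} (w : Walk G a b) (κ t : ℝ) : Set where
      constructor crossing
      field
        c     : Vertex
        w₁    : Walk G a c
        w₂    : Walk G c b
        w≡    : w ≡ w₁ ++ʷ w₂
        below : H c ≤ t
        above : t ≤ H c + κ

    crossing-at : ∀ {κ} → Weighted0κ G κ → ∀ t {a b} → Walk G o a → (w : Walk G a b) →
                  H b ≤ t → t < H a → Crossing w κ t
    crossing-at wκ t oa [ a ] Hb≤t t<Ha = ⊥-elim (<⇒≱ t<Ha Hb≤t)
    crossing-at {κ} wκ t {a} oa (_∷⟨_⟩_ {a′} .a e w) Hb≤t t<Ha with ≤-<-connex (H a′) t
    ... | inj₁ Ha′≤t = crossing a′ (edge e) w refl Ha′≤t (begin
          t                      ≤⟨ <⇒≤ t<Ha ⟩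
          H a                    ≤⟨ distance-triangle′ oa (edge e) ⟩
          H a′ + weight G (edge e) ≡⟨ cong (H a′ +_) (weight-edge e) ⟩
          H a′ + φ a a′          ≤⟨ +-monoʳ-≤ (H a′) (wκ a a′ e) ⟩
          H a′ + κ               ∎)
      where open ≤-Reasoning
    ... | inj₂ t<Ha′ with crossing-at wκ t (oa ++ʷ edge e) w Hb≤t t<Ha′
    ...   | crossing c w₁ w₂ refl Hc≤t t≤Hc+κ = crossing c (a ∷⟨ e ⟩ w₁) w₂ refl Hc≤t t≤Hc+κ

module Roots (Rs : RealNumbers) (G : WithReals.WGraph Rs) where
  open OrderedField Rs
  open WithReals Rs
  open WGraph G
  open Walks Rs G
  open Distances Rs G

  reachable? : ∀ s v → Dec (Walk G s v)
  reachable? s v with shortest n s v in eq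
  ... | just d  = yes (Realised.walk (shortest-sound n s v eq))
  ... | nothing = no λ w → unreachable (shortest-reachable w)
    where
    unreachable : ∀ {t} → ¬ (shortest n s v ≤ᵐ t)
    unreachable (_ , eq′ , _) with trans (sym eq) eq′
    ... | ()

  private
    leastReachable : ∀ v → Σ Vertex λ o → Walk G v o × (∀ j → j F.< o → ¬ Walk G v j)
    leastReachable v = least-witness (reachable? v) (v , [ v ])

  root : Vertex → Vertex
  root v = proj₁ (leastReachable v)

  toRoot : ∀ v → Walk G v (root v)
  toRoot v = proj₁ (proj₂ (leastReachable v))

  root-cong : ∀ {u v} → Walk G u v → root u ≡ root v
  root-cong {u} {v} uv with F.<-cmp (root u) (root v)
  ... | tri< ru<rv _ _ = ⊥-elim (proj₂ (proj₂ (leastReachable v)) (root u) ru<rv (reverse uv ++ʷ toRoot u))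
  ... | tri≈ _ ru≡rv _ = ru≡rv
  ... | tri> _ _ rv<ru = ⊥-elim (proj₂ (proj₂ (leastReachable u)) (root v) rv<ru (uv ++ʷ toRoot v))

module LayerPartition (Rs : RealNumbers) (G : WithReals.WGraph Rs) (p q : ℕ) (r κ : RealNumbers.ℝ Rs)
                 (p≥2 : 2 ℕ.≤ p) (q≥1 : 1 ℕ.≤ q) (r>0 : RealNumbers._<_ Rs (RealNumbers.0r Rs) r)
                 (κ>0 : RealNumbers._<_ Rs (RealNumbers.0r Rs) κ) (wκ : WithReals.Weighted0κ Rs G κ) where
  open OrderedField Rs
  open WithReals Rs
  open WGraph G
  open Walks Rs G
  open Distances Rs G
  open Roots Rs G

  Q : ℝ
  Q = fromℕ q

  width : ℝ
  width = r + (Q + κ)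

  Δ : ℝ
  Δ = fromℕ 5 * r + fromℕ 9 * Q + fromℕ 9 * κ

  D : ℝ
  D = fatBound Rs p q r κ

  -- L − t₃ for the levels t₁ > t₂ > t₃ cut below a layer at height L, spaced r + Q, Q + κ and Q + κ apart
  M : ℝ
  M = r + (Q + (Q + Q)) + (κ + κ)

  -- bound on the length of a column hanging from the chain
  δ : ℝ
  δ = κ + M + width

  0<Q : 0r < Q
  0<Q = 0<fromℕ q≥1

  0≤r : 0r ≤ r
  0≤r = <⇒≤ r>0

  0≤Q : 0r ≤ Q
  0≤Q = <⇒≤ 0<Q

  0≤κ : 0r ≤ κ
  0≤κ = <⇒≤ κ>0

  0<width : 0r < width
  0<width = <-≤-trans r>0 (x≤x+y r (+-nonNeg 0≤Q 0≤κ))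

  r<width : r < width
  r<width = x<x+y r (<-≤-trans 0<Q (x≤x+y Q 0≤κ))

  κ≤width : κ ≤ width
  κ≤width = ≤-trans (x≤y+x κ 0≤Q) (x≤y+x (Q + κ) 0≤r)

  Δ≡ : Δ ≡ 5 ×ᵣ r + 9 ×ᵣ Q + 9 ×ᵣ κ
  Δ≡ = cong₂ _+_ (cong₂ _+_ (fromℕ-*≡×ᵣ 5 r) (fromℕ-*≡×ᵣ 9 Q)) (fromℕ-*≡×ᵣ 9 κ)

  0≤Δ : 0r ≤ Δ
  0≤Δ = +-nonNeg (+-nonNeg (*-nonNeg 5 0≤r) (*-nonNeg 9 0≤Q)) (*-nonNeg 9 0≤κ)

  width+M≤Δ : width + M ≤ Δ
  width+M≤Δ = ≤-by (3 ×ᵣ r + 5 ×ᵣ Q + 6 ×ᵣ κ)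
    (trans (solve 3 (λ r Q κ → ((r ⊕ (Q ⊕ κ)) ⊕ ((r ⊕ (Q ⊕ (Q ⊕ Q))) ⊕ (κ ⊕ κ))) ⊕ ((3 ×⊕ r ⊕ 5 ×⊕ Q) ⊕ 6 ×⊕ κ)
                             ⊜ (5 ×⊕ r ⊕ 9 ×⊕ Q) ⊕ 9 ×⊕ κ) refl r Q κ) (sym Δ≡))
    (+-nonNeg (+-nonNeg (×ᵣ-nonNeg 3 0≤r) (×ᵣ-nonNeg 5 0≤Q)) (×ᵣ-nonNeg 6 0≤κ))

  Δ+Δ≤D : Δ + Δ ≤ D
  Δ+Δ≤D = begin
    Δ + Δ              ≡⟨ cong (Δ +_) (+-identityʳ Δ) ⟨
    2 ×ᵣ Δ             ≡⟨ fromℕ-*≡×ᵣ 2 Δ ⟨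
    fromℕ 2 * Δ        ≤⟨ *-monoˡ-≤ Δ p≥2 0≤Δ ⟩
    fromℕ p * Δ        ≡⟨ *-comm (fromℕ p) Δ ⟩
    D                  ∎
    where open ≤-Reasoning

  -- consecutive columns are separated by Δ minus the spread r of a selected chain point
  Q+2δ+r+κ≡Δ : Q + δ + δ + r + κ ≡ Δ
  Q+2δ+r+κ≡Δ = trans (solve 3 (λ r Q κ →
                   ((((Q ⊕ ((κ ⊕ ((r ⊕ (Q ⊕ (Q ⊕ Q))) ⊕ (κ ⊕ κ))) ⊕ (r ⊕ (Q ⊕ κ))))
                     ⊕ ((κ ⊕ ((r ⊕ (Q ⊕ (Q ⊕ Q))) ⊕ (κ ⊕ κ))) ⊕ (r ⊕ (Q ⊕ κ)))) ⊕ r) ⊕ κ)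
                   ⊜ (5 ×⊕ r ⊕ 9 ×⊕ Q) ⊕ 9 ×⊕ κ) refl r Q κ) (sym Δ≡)

  height : Vertex → ℝ
  height v = distance (root v) v

  layerFloor : ∀ v → Floor width (height v)
  layerFloor v = floor (suc n) (distance-nonNeg _ _) (begin-strict
    height v                  ≤⟨ distance≤nκ wκ 0≤κ _ _ ⟩
    fromℕ n * κ               ≤⟨ *-monoʳ-≤ n κ≤width ⟩
    fromℕ n * width           <⟨ x<x+y _ 0<width ⟩
    fromℕ n * width + width   ≡⟨ +-comm _ width ⟩
    width + fromℕ n * width   ≡⟨ fromℕ-suc-* n width ⟨
    fromℕ (suc n) * width     ∎)
    where open ≤-Reasoning

  layer : Vertex → ℕ
  layer v = Floor.k (layerFloor v)

  Class : Bool → Pred G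
  Class b v = parity (layer v) ≡ b

  -- layers of equal parity are a full width apart, which exceeds r
  same-parity-layers-far : ∀ {u v} → parity (layer u) ≡ parity (layer v) → layer u ℕ.< layer v →
                           height u + r < height v
  same-parity-layers-far {u} {v} eq lu<lv = begin-strict
    height u + r                   <⟨ +-monoˡ-< r (Floor.upper (layerFloor u)) ⟩
    X + r                          <⟨ +-monoʳ-< X r<width ⟩
    X + width                      ≡⟨ +-comm X width ⟩
    width + X                      ≡⟨ fromℕ-suc-* (suc (layer u)) width ⟨
    fromℕ (2 ℕ.+ layer u) * width  ≤⟨ *-monoˡ-≤ width (parity-gap eq lu<lv) (<⇒≤ 0<width) ⟩
    fromℕ (layer v) * width        ≤⟨ Floor.lower (layerFloor v) ⟩
    height v                       ∎
    where
    open ≤-Reasoning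
    X = fromℕ (suc (layer u)) * width

  same-class-same-layer : ∀ {b u v} → Class b u → Class b v → height v ≤ height u + r → height u ≤ height v + r →
                          layer u ≡ layer v
  same-class-same-layer {u = u} {v} cu cv hv≤ hu≤ with ℕ.<-cmp (layer u) (layer v)
  ... | tri< lu<lv _ _ = ⊥-elim (<⇒≱ (same-parity-layers-far (trans cu (sym cv)) lu<lv) hv≤)
  ... | tri≈ _ lu≡lv _ = lu≡lv
  ... | tri> _ _ lv<lu = ⊥-elim (<⇒≱ (same-parity-layers-far (trans cv (sym cu)) lv<lu) hu≤)

  -- The vertices of class b in the layer of x and in the component of x; r-chains of class b stay inside it.
  module Stratum (b : Bool) (x : Vertex) where
    o : Vertex
    o = root x

    open Descending o public

    g : Vertex → ℝ
    g = distance x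

    L : ℝ
    L = fromℕ (layer x) * width

    record InStratum (u : Vertex) : Set where
      constructor stratum
      field
        fromRoot : Walk G o u
        class    : Class b u
        layer≡   : layer u ≡ layer x
    open InStratum public

    fromX : ∀ {u} → InStratum u → Walk G x u
    fromX su = toRoot x ++ʷ fromRoot su

    height≡H : ∀ {u} → Walk G o u → height u ≡ H u
    height≡H ou = cong (λ z → distance z _) (sym (root-cong (toRoot x ++ʷ ou)))

    stratum-lower : ∀ {u} → InStratum u → L ≤ H u
    stratum-lower {u} (stratum ou _ lu≡lx) =
      subst₂ _≤_ (cong (λ k → fromℕ k * width) lu≡lx) (height≡H ou) (Floor.lower (layerFloor u))

    stratum-upper : ∀ {u} → InStratum u → H u < width + L
    stratum-upper {u} (stratum ou _ lu≡lx) =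
      subst₂ _<_ (height≡H ou) (trans (cong (λ k → fromℕ (suc k) * width) lu≡lx) (fromℕ-suc-* (layer x) width))
        (Floor.upper (layerFloor u))

    stratum-step : ∀ {u v} → InStratum u → Class b v → DistLe G u v r → InStratum v
    stratum-step {u} {v} (stratum ou cu lu) cv (w , _ , w≤r) = stratum ov cv (trans (sym lu≡lv) lu)
      where
      ov = ou ++ʷ w
      lu≡lv : layer u ≡ layer v
      lu≡lv = same-class-same-layer cu cv
        (subst₂ _≤_ (sym (height≡H ov)) (cong (_+ r) (sym (height≡H ou)))
          (≤-trans (distance-triangle ou w) (+-monoʳ-≤ (H u) w≤r)))
        (subst₂ _≤_ (sym (height≡H ou)) (cong (_+ r) (sym (height≡H ov)))
          (≤-trans (distance-triangle′ ou w) (+-monoʳ-≤ (H v) w≤r)))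

    Chain : Vertex → Vertex → Set
    Chain = RChain G (Class b) r

    chainWalk : ∀ {z y} → Chain z y → Walk G z y
    chainWalk (stop {z} _)            = [ z ]
    chainWalk (step _ (w , _ , _) ch) = w ++ʷ chainWalk ch

    chain-start : ∀ {z y} → Chain z y → Class b z
    chain-start (stop cz)     = cz
    chain-start (step cz _ _) = cz

    chain-end : ∀ {z y} → InStratum z → Chain z y → InStratum y
    chain-end sz (stop _)       = sz
    chain-end sz (step _ d ch) = chain-end (stratum-step sz (chain-start ch) d) ch

    chain-above : ∀ {z y} → InStratum z → (ch : Chain z y) → ∀ {u} → u ∈ vertices G (chainWalk ch) → L ≤ H u + r
    chain-above sz (stop _) (here refl) = ≤-trans (stratum-lower sz) (x≤x+y _ 0≤r)
    chain-above sz (step _ d@(w , _ , w≤r) ch) u∈ with ∈-++⁻ w (chainWalk ch) u∈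
    ... | inj₁ u∈w  = ≤-trans (stratum-lower sz)
                        (≤-trans (distance-triangle′ (fromRoot sz) (prefix w u∈w))
                          (+-monoʳ-≤ _ (≤-trans (weight-prefix≤ w u∈w) w≤r)))
    ... | inj₂ u∈ch = chain-above (stratum-step sz (chain-start ch) d) ch u∈ch

    -- a point where the chain, whose steps change g by at most r, reaches level θ of g
    record Reaches {z y} (ch : Chain z y) (θ : ℝ) : Set where
      field
        point     : Vertex
        onChain   : point ∈ vertices G (chainWalk ch)
        inStratum : InStratum point
        lower     : θ ≤ g point
        upper     : g point < θ + r

    reaches : ∀ θ {z y} → InStratum z → (ch : Chain z y) → g z < θ + r → θ ≤ g y → Reaches ch θ
    reaches θ {z} sz ch gz<θ+r θ≤gy with ≤-<-connex θ (g z)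
    ... | inj₁ θ≤gz = record { point = z ; onChain = ∈-start (chainWalk ch) ; inStratum = sz ; lower = θ≤gz ; upper = gz<θ+r }
    reaches θ sz (stop _) gz<θ+r θ≤gy | inj₂ gz<θ = ⊥-elim (<⇒≱ gz<θ θ≤gy)
    reaches θ sz (step _ d@(w , _ , w≤r) ch) gz<θ+r θ≤gy | inj₂ gz<θ =
      record { Reaches rest ; onChain = ∈-++⁺ʳ w (chainWalk ch) (Reaches.onChain rest) }
      where
      rest = reaches θ (stratum-step sz (chain-start ch) d) ch
               (≤-<-trans (distance-triangle (fromX sz) w) (+-mono-<-≤ gz<θ w≤r)) θ≤gy

    origin : ∀ {y} → Chain x y → InStratum x
    origin ch = stratum (reverse (toRoot x)) (chain-start ch) refl

    shallow-stratum-close : ∀ {v} → InStratum x → InStratum v → L < M → g v < D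
    shallow-stratum-close sx sv L<M = begin-strict
      g _                        ≤⟨ distance-via (fromRoot sx) (fromRoot sv) ⟩
      H x + H _                  <⟨ +-mono-<-≤ (below sx) (<⇒≤ (below sv)) ⟩
      (width + M) + (width + M)  ≤⟨ +-mono-≤ width+M≤Δ width+M≤Δ ⟩
      Δ + Δ                      ≤⟨ Δ+Δ≤D ⟩
      D                          ∎
      where
      open ≤-Reasoning
      below : ∀ {u} → InStratum u → H u < width + M
      below su = <-trans (stratum-upper su) (+-monoʳ-< width L<M)

    -- Below a deep enough layer there is room for p disjoint columns from the chain down towards o;
    -- together with the chain and the ball of radius t₃ around o they form a q-fat K₂,ₚ.
    module Deep {y} (ch : Chain x y) (far : D < g y) (M≤L : M ≤ L) where
      sx : InStratum x
      sx = origin ch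

      t₃ t₂ t₁ : ℝ
      t₃ = L + - M
      t₂ = t₃ + (Q + κ)
      t₁ = t₂ + (Q + κ)

      L≡t₃+M : L ≡ t₃ + M
      L≡t₃+M = sym (x-z+z≡x L M)

      L≡t₁+r+Q : L ≡ t₁ + (r + Q)
      L≡t₁+r+Q = trans L≡t₃+M (solve 4 (λ t r Q κ → t ⊕ ((r ⊕ (Q ⊕ (Q ⊕ Q))) ⊕ (κ ⊕ κ))
                                          ⊜ ((t ⊕ (Q ⊕ κ)) ⊕ (Q ⊕ κ)) ⊕ (r ⊕ Q)) refl t₃ r Q κ)

      0≤Q+κ : 0r ≤ Q + κ
      0≤Q+κ = +-nonNeg 0≤Q 0≤κ

      0≤t₃ : 0r ≤ t₃
      0≤t₃ = +-cancelʳ-≤ M (subst₂ _≤_ (sym (+-identityˡ M)) L≡t₃+M M≤L)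

      0≤t₂ : 0r ≤ t₂
      0≤t₂ = +-nonNeg 0≤t₃ 0≤Q+κ

      0≤t₁ : 0r ≤ t₁
      0≤t₁ = +-nonNeg 0≤t₂ 0≤Q+κ

      t₁<L : t₁ < L
      t₁<L = subst (t₁ <_) (sym L≡t₁+r+Q) (x<x+y t₁ (<-≤-trans r>0 (x≤x+y r 0≤Q)))

      H-root≤ : ∀ {t} → 0r ≤ t → H o ≤ t
      H-root≤ = subst (_≤ _) (sym (distance-self o))

      below-next-level : ∀ {t h} → t + (Q + κ) ≤ h + κ → t < h
      below-next-level {t} {h} le = <-≤-trans (x<x+y t 0<Q) (+-cancelʳ-≤ κ (≤-trans (≤-reflexive (+-assoc t Q κ)) le))

      ball-chain-gap : Q + t₃ + r ≤ L
      ball-chain-gap = ≤-by ((Q + Q) + (κ + κ))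
        (trans (solve 4 (λ t r Q κ → ((Q ⊕ t) ⊕ r) ⊕ ((Q ⊕ Q) ⊕ (κ ⊕ κ)) ⊜ t ⊕ ((r ⊕ (Q ⊕ (Q ⊕ Q))) ⊕ (κ ⊕ κ)))
                  refl t₃ r Q κ) (sym L≡t₃+M))
        (+-nonNeg (+-nonNeg 0≤Q 0≤Q) (+-nonNeg 0≤κ 0≤κ))

      ball-rung-gap : Q + t₃ + κ ≤ t₂
      ball-rung-gap = ≤-reflexive (solve 3 (λ t Q κ → (Q ⊕ t) ⊕ κ ⊜ t ⊕ (Q ⊕ κ)) refl t₃ Q κ)

      ball-upper-gap : Q + t₃ + κ ≤ t₁
      ball-upper-gap = ≤-by (Q + κ) (solve 3 (λ t Q κ → ((Q ⊕ t) ⊕ κ) ⊕ (Q ⊕ κ) ⊜ (t ⊕ (Q ⊕ κ)) ⊕ (Q ⊕ κ)) refl t₃ Q κ) 0≤Q+κ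

      rung-chain-gap : Q + t₁ + r ≤ L
      rung-chain-gap = ≤-reflexive (trans (solve 3 (λ t r Q → (Q ⊕ t) ⊕ r ⊜ t ⊕ (r ⊕ Q)) refl t₁ r Q) (sym L≡t₁+r+Q))

      lower-upper-gap : Q + t₂ + κ ≤ t₁
      lower-upper-gap = ≤-reflexive (solve 3 (λ t Q κ → (Q ⊕ t) ⊕ κ ⊜ t ⊕ (Q ⊕ κ)) refl t₂ Q κ)

      lower-chain-gap : Q + t₂ + r ≤ L
      lower-chain-gap = ≤-by (Q + κ)
        (trans (solve 4 (λ t r Q κ → ((Q ⊕ t) ⊕ r) ⊕ (Q ⊕ κ) ⊜ (t ⊕ (Q ⊕ κ)) ⊕ (r ⊕ Q)) refl t₂ r Q κ) (sym L≡t₁+r+Q))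
        0≤Q+κ

      record Column (top : Vertex) : Set where
        field
          v₁ v₂ v₃ : Vertex
          upper    : Walk G top v₁
          rung     : Walk G v₁ v₂
          lower    : Walk G v₂ v₃
          descends : Descends (upper ++ʷ rung ++ʷ lower)
          v₁-below : H v₁ ≤ t₁
          v₁-above : t₁ ≤ H v₁ + κ
          v₂-below : H v₂ ≤ t₂
          v₂-above : t₂ ≤ H v₂ + κ
          v₃-below : H v₃ ≤ t₃
          v₃-above : t₃ ≤ H v₃ + κ

      -- follow a geodesic from the top back to o, cutting it where it crosses the levels t₁, t₂, t₃
      column : ∀ {u} → InStratum u → Column u
      column {u} su = record
        { v₁ = c A ; v₂ = c B ; v₃ = c C ; upper = w₁ A ; rung = w₁ B ; lower = w₁ C
        ; descends = descends-prefix ou (w₁ A ++ʷ w₁ B ++ʷ w₁ C) (w₂ C) (subst Descends R≡ R-descends)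
        ; v₁-below = below A ; v₁-above = above A ; v₂-below = below B ; v₂-above = above B
        ; v₃-below = below C ; v₃-above = above C }
        where
        open Crossing
        ou = fromRoot su
        γ  = geodesic ou
        R  = reverse (Geodesic.path γ)
        R-descends : Descends R
        R-descends = ≤-reflexive (begin-equality
          H o + weight G R                ≡⟨ cong₂ _+_ (distance-self o) (weight-reverse (Geodesic.path γ)) ⟩
          0r + weight G (Geodesic.path γ) ≡⟨ +-identityˡ _ ⟩
          weight G (Geodesic.path γ)      ≡⟨ Geodesic.weight≡ γ ⟩
          H u                             ∎)
          where open ≤-Reasoning
        A : Crossing R κ t₁
        A = crossing-at wκ t₁ ou R (H-root≤ 0≤t₁) (<-≤-trans t₁<L (stratum-lower su))
        B : Crossing (w₂ A) κ t₂
        B = crossing-at wκ t₂ (ou ++ʷ w₁ A) (w₂ A) (H-root≤ 0≤t₂) (below-next-level (above A))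
        C : Crossing (w₂ B) κ t₃
        C = crossing-at wκ t₃ ((ou ++ʷ w₁ A) ++ʷ w₁ B) (w₂ B) (H-root≤ 0≤t₃) (below-next-level (above B))
        R≡ : R ≡ (w₁ A ++ʷ w₁ B ++ʷ w₁ C) ++ʷ w₂ C
        R≡ = begin
          R                                           ≡⟨ w≡ A ⟩
          w₁ A ++ʷ w₂ A                               ≡⟨ cong (w₁ A ++ʷ_) (trans (w≡ B) (cong (w₁ B ++ʷ_) (w≡ C))) ⟩
          w₁ A ++ʷ w₁ B ++ʷ w₁ C ++ʷ w₂ C             ≡⟨ cong (w₁ A ++ʷ_) (++ʷ-assoc (w₁ B) (w₁ C) (w₂ C)) ⟨
          w₁ A ++ʷ (w₁ B ++ʷ w₁ C) ++ʷ w₂ C           ≡⟨ ++ʷ-assoc (w₁ A) (w₁ B ++ʷ w₁ C) (w₂ C) ⟨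
          (w₁ A ++ʷ w₁ B ++ʷ w₁ C) ++ʷ w₂ C           ∎
          where open ≡-Reasoning

      module ColumnAt {u} (su : InStratum u) where
        open Column (column su) public

        colWalk : Walk G u v₃
        colWalk = upper ++ʷ rung ++ʷ lower

        ou : Walk G o u
        ou = fromRoot su

        -- the column descends from below width + L to above t₃ − κ = L − M − κ
        colWalk-short : weight G colWalk ≤ δ
        colWalk-short = +-cancelˡ-≤ (H v₃) (begin
          H v₃ + weight G colWalk    ≤⟨ descends ⟩
          H u                        ≤⟨ <⇒≤ (stratum-upper su) ⟩
          width + L                  ≡⟨ cong (width +_) L≡t₃+M ⟩
          width + (t₃ + M)           ≤⟨ +-monoʳ-≤ width (+-monoˡ-≤ M v₃-above) ⟩
          width + (H v₃ + κ + M)     ≡⟨ solve 4 (λ w h k m → w ⊕ ((h ⊕ k) ⊕ m) ⊜ h ⊕ ((k ⊕ m) ⊕ w)) refl width (H v₃) κ M ⟩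
          H v₃ + δ                   ∎)
          where open ≤-Reasoning

        colWalk-near : ∀ {v} → v ∈ vertices G colWalk → g v ≤ g u + δ × g u ≤ g v + δ
        colWalk-near v∈ =
          ≤-trans (distance-triangle (fromX su) (prefix colWalk v∈)) (+-monoʳ-≤ _ short) ,
          ≤-trans (distance-triangle′ (fromX su) (prefix colWalk v∈)) (+-monoʳ-≤ _ short)
          where short = ≤-trans (weight-prefix≤ colWalk v∈) colWalk-short

        upper⊆ : ∀ {v} → v ∈ vertices G upper → v ∈ vertices G colWalk
        upper⊆ = ∈-++⁺ˡ upper _

        rung⊆ : ∀ {v} → v ∈ vertices G rung → v ∈ vertices G colWalk
        rung⊆ v∈ = ∈-++⁺ʳ upper _ (∈-++⁺ˡ rung lower v∈)

        lower⊆ : ∀ {v} → v ∈ vertices G lower → v ∈ vertices G colWalk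
        lower⊆ v∈ = ∈-++⁺ʳ upper _ (∈-++⁺ʳ rung lower v∈)

        inComponent : ∀ {v} → v ∈ vertices G colWalk → Walk G o v
        inComponent v∈ = ou ++ʷ prefix colWalk v∈

        upper-above : ∀ {v} → v ∈ vertices G upper → t₁ ≤ H v + κ
        upper-above v∈ = ≤-trans v₁-above (+-monoˡ-≤ κ (proj₁ (descends-between ou upper
                           (descends-prefix ou upper (rung ++ʷ lower) descends) v∈)))

        rung-lower-descends : Descends (rung ++ʷ lower)
        rung-lower-descends = descends-suffix ou upper (rung ++ʷ lower) descends

        rung-between : ∀ {v} → v ∈ vertices G rung → H v ≤ t₁ × t₂ ≤ H v + κ
        rung-between v∈ = ≤-trans (proj₂ bounds) v₁-below , ≤-trans v₂-above (+-monoˡ-≤ κ (proj₁ bounds))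
          where
          bounds = descends-between (ou ++ʷ upper) rung (descends-prefix (ou ++ʷ upper) rung lower rung-lower-descends) v∈

        lower-below : ∀ {v} → v ∈ vertices G lower → H v ≤ t₂
        lower-below v∈ = ≤-trans (proj₂ (descends-between ((ou ++ʷ upper) ++ʷ rung) lower
                           (descends-suffix (ou ++ʷ upper) rung lower rung-lower-descends) v∈)) v₂-below

      θ : Fin p → ℝ
      θ j = fromℕ (toℕ j) * Δ

      anchor : (j : Fin p) → Reaches ch (θ j)
      anchor j = reaches (θ j) sx ch
        (subst (_< θ j + r) (sym (distance-self x)) (≤-<-trans (*-nonNeg (toℕ j) 0≤Δ) (x<x+y (θ j) r>0)))
        (≤-trans (*-monoˡ-≤ Δ (ℕ.<⇒≤ (F.toℕ<n j)) 0≤Δ) (≤-trans (≤-reflexive (*-comm (fromℕ p) Δ)) (<⇒≤ far)))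

      top : Fin p → Vertex
      top j = Reaches.point (anchor j)

      module Col (j : Fin p) = ColumnAt (Reaches.inStratum (anchor j))

      NearColumn : Fin p → Pred G
      NearColumn j v = Walk G o v × g v ≤ g (top j) + δ × g (top j) ≤ g v + δ

      colWalk-nearColumn : ∀ j {v} → v ∈ vertices G (Col.colWalk j) → NearColumn j v
      colWalk-nearColumn j v∈ = Col.inComponent j v∈ , Col.colWalk-near j v∈

      tops-gap : ∀ {j k} → toℕ j ℕ.< toℕ k → Q + (g (top j) + δ) + δ ≤ g (top k)
      tops-gap {j} {k} j<k = +-cancelʳ-≤ r (<⇒≤ (begin-strict
        Q + (g (top j) + δ) + δ + r       ≤⟨ ≤-by κ (trans (solve 5 (λ Q gj δ r κ → (((Q ⊕ (gj ⊕ δ)) ⊕ δ) ⊕ r) ⊕ κ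
                                                                   ⊜ gj ⊕ ((((Q ⊕ δ) ⊕ δ) ⊕ r) ⊕ κ)) refl Q (g (top j)) δ r κ)
                                                  (cong (g (top j) +_) Q+2δ+r+κ≡Δ)) 0≤κ ⟩
        g (top j) + Δ                     <⟨ +-monoˡ-< Δ (Reaches.upper (anchor j)) ⟩
        θ j + r + Δ                       ≡⟨ solve 3 (λ θ r Δ → (θ ⊕ r) ⊕ Δ ⊜ (Δ ⊕ θ) ⊕ r) refl (θ j) r Δ ⟩
        Δ + θ j + r                       ≡⟨ cong (_+ r) (fromℕ-suc-* (toℕ j) Δ) ⟨
        fromℕ (suc (toℕ j)) * Δ + r       ≤⟨ +-monoˡ-≤ r (*-monoˡ-≤ Δ j<k 0≤Δ) ⟩
        θ k + r                           ≤⟨ +-monoˡ-≤ r (Reaches.lower (anchor k)) ⟩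
        g (top k) + r                     ∎))
        where open ≤-Reasoning

      columns-far : ∀ j k → j ≢ k → (S S′ : Pred G) → (∀ v → S v → NearColumn j v) → (∀ v → S′ v → NearColumn k v) →
                    SetDistGe G S S′ Q
      columns-far j k j≢k S S′ nearS nearS′ = [ j-before-k , k-before-j ]′ (≢⇒<⊎> j≢k)
        where
        j-before-k : toℕ j ℕ.< toℕ k → SetDistGe G S S′ Q
        j-before-k j<k = levels-far x S S′ {g (top j) + δ} {g (top k)} {δ} {Q}
          (λ v Sv → toRoot x ++ʷ proj₁ (nearS v Sv)) (λ v Sv → proj₁ (proj₂ (nearS v Sv)))
          (λ v S′v → proj₂ (proj₂ (nearS′ v S′v))) (tops-gap j<k)
        k-before-j : toℕ k ℕ.< toℕ j → SetDistGe G S S′ Q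
        k-before-j k<j = levels-far′ x S′ S {g (top k) + δ} {g (top j)} {δ} {Q}
          (λ v Sv → toRoot x ++ʷ proj₁ (nearS v Sv)) (λ v S′v → proj₁ (proj₂ (nearS′ v S′v)))
          (λ v Sv → proj₂ (proj₂ (nearS v Sv))) (tops-gap k<j)

      Ball : Pred G
      Ball v = Walk G o v × H v ≤ t₃

      OnChain : Pred G
      OnChain v = v ∈ vertices G (chainWalk ch)

      Rung : Fin p → Pred G
      Rung j v = v ∈ vertices G (Col.rung j)

      lowerPath : (j : Fin p) → PathBetween G Ball (Rung j)
      lowerPath j = record
        { start = Col.v₃ j ; end = Col.v₂ j
        ; start∈A = Col.inComponent j (∈-end (Col.colWalk j)) , Col.v₃-below j ; end∈B = ∈-end (Col.rung j)
        ; walk = Shortcut.path (shortcut (reverse (Col.lower j))) ; isPath = Shortcut.isPath (shortcut (reverse (Col.lower j))) }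

      upperPath : (j : Fin p) → PathBetween G OnChain (Rung j)
      upperPath j = record
        { start = top j ; end = Col.v₁ j
        ; start∈A = Reaches.onChain (anchor j) ; end∈B = ∈-start (Col.rung j)
        ; walk = Shortcut.path (shortcut (Col.upper j)) ; isPath = Shortcut.isPath (shortcut (Col.upper j)) }

      lowerPath⊆ : ∀ j {v} → onPath G (lowerPath j) v → v ∈ vertices G (Col.lower j)
      lowerPath⊆ j v∈ = ∈-reverse⁻ (Col.lower j) (Shortcut.⊆walk (shortcut (reverse (Col.lower j))) v∈)

      upperPath⊆ : ∀ j {v} → onPath G (upperPath j) v → v ∈ vertices G (Col.upper j)
      upperPath⊆ j v∈ = Shortcut.⊆walk (shortcut (Col.upper j)) v∈

      ball-reach : ∀ v → Ball v → Walk G o v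
      ball-reach v = proj₁

      chain-reach : ∀ v → OnChain v → Walk G o v
      chain-reach v v∈ = fromRoot sx ++ʷ prefix (chainWalk ch) v∈

      rung-near : ∀ j v → Rung j v → NearColumn j v
      rung-near j v v∈ = colWalk-nearColumn j (Col.rung⊆ j v∈)

      lowerPath-near : ∀ j v → onPath G (lowerPath j) v → NearColumn j v
      lowerPath-near j v v∈ = colWalk-nearColumn j (Col.lower⊆ j (lowerPath⊆ j v∈))

      upperPath-near : ∀ j v → onPath G (upperPath j) v → NearColumn j v
      upperPath-near j v v∈ = colWalk-nearColumn j (Col.upper⊆ j (upperPath⊆ j v∈))

      reach : ∀ j {S : Pred G} → (∀ v → S v → NearColumn j v) → ∀ v → S v → Walk G o v
      reach j near v Sv = proj₁ (near v Sv)

      Branch : Fin (2 ℕ.+ p) → Pred G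
      Branch F.zero             = Ball
      Branch (F.suc F.zero)     = OnChain
      Branch (F.suc (F.suc j)) = Rung j

      branches-far : ∀ u v → u ≢ v → SetDistGe G (Branch u) (Branch v) Q
      branches-far F.zero             F.zero             0≢0 = ⊥-elim (0≢0 refl)
      branches-far (F.suc F.zero)     (F.suc F.zero)     1≢1 = ⊥-elim (1≢1 refl)
      branches-far F.zero             (F.suc F.zero)     _ =
        levels-far  o Ball OnChain ball-reach (λ _ → proj₂) (λ v → chain-above sx ch) ball-chain-gap
      branches-far (F.suc F.zero)     F.zero             _ =
        levels-far′ o Ball OnChain chain-reach (λ _ → proj₂) (λ v → chain-above sx ch) ball-chain-gap
      branches-far F.zero             (F.suc (F.suc k)) _ =
        levels-far  o Ball (Rung k) ball-reach (λ _ → proj₂) (λ v v∈ → proj₂ (Col.rung-between k v∈)) ball-rung-gap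
      branches-far (F.suc (F.suc k)) F.zero             _ =
        levels-far′ o Ball (Rung k) (reach k (rung-near k)) (λ _ → proj₂) (λ v v∈ → proj₂ (Col.rung-between k v∈)) ball-rung-gap
      branches-far (F.suc F.zero)     (F.suc (F.suc k)) _ =
        levels-far′ o (Rung k) OnChain chain-reach (λ v v∈ → proj₁ (Col.rung-between k v∈)) (λ v → chain-above sx ch) rung-chain-gap
      branches-far (F.suc (F.suc k)) (F.suc F.zero)     _ =
        levels-far  o (Rung k) OnChain (reach k (rung-near k)) (λ v v∈ → proj₁ (Col.rung-between k v∈)) (λ v → chain-above sx ch) rung-chain-gap
      branches-far (F.suc (F.suc j)) (F.suc (F.suc k)) j≢k =
        columns-far j k (λ j≡k → j≢k (cong (λ i → F.suc (F.suc i)) j≡k)) (Rung j) (Rung k) (rung-near j) (rung-near k)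

      data Edge : Fin (2 ℕ.+ p) → Fin (2 ℕ.+ p) → Set where
        ball–rung  : ∀ j → Edge F.zero (F.suc (F.suc j))
        chain–rung : ∀ j → Edge (F.suc F.zero) (F.suc (F.suc j))

      asEdge : ∀ u v → u F.< v → K2-Adj p u v ≡ true → Edge u v
      asEdge F.zero             F.zero             ()               _
      asEdge F.zero             (F.suc F.zero)     _                ()
      asEdge F.zero             (F.suc (F.suc j)) _                _  = ball–rung j
      asEdge (F.suc F.zero)     F.zero             ()               _
      asEdge (F.suc F.zero)     (F.suc F.zero)     (ℕ.s≤s ())       _
      asEdge (F.suc F.zero)     (F.suc (F.suc j)) _                _  = chain–rung j
      asEdge (F.suc (F.suc _)) F.zero             ()               _
      asEdge (F.suc (F.suc _)) (F.suc F.zero)     (ℕ.s≤s ())       _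
      asEdge (F.suc (F.suc _)) (F.suc (F.suc _)) _                ()

      edgePath : ∀ {u v} → Edge u v → PathBetween G (Branch u) (Branch v)
      edgePath (ball–rung j)  = lowerPath j
      edgePath (chain–rung j) = upperPath j

      lowerPath-below : ∀ j v → onPath G (lowerPath j) v → H v ≤ t₂
      lowerPath-below j v v∈ = Col.lower-below j (lowerPath⊆ j v∈)

      upperPath-above : ∀ j v → onPath G (upperPath j) v → t₁ ≤ H v + κ
      upperPath-above j v v∈ = Col.upper-above j (upperPath⊆ j v∈)

      Lower Upper : Fin p → Pred G
      Lower j = onPath G (lowerPath j)
      Upper j = onPath G (upperPath j)

      lower-upper-far : ∀ j k → SetDistGe G (Lower j) (Upper k) Q
      lower-upper-far j k = by-cases (j F.≟ k)
        where
        by-cases : Dec (j ≡ k) → SetDistGe G (Lower j) (Upper k) Q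
        by-cases (yes j≡k) = subst (λ i → SetDistGe G (Lower j) (Upper i) Q) j≡k
          (levels-far o (Lower j) (Upper j) (reach j (lowerPath-near j)) (lowerPath-below j) (upperPath-above j) lower-upper-gap)
        by-cases (no j≢k)  = columns-far j k j≢k (Lower j) (Upper k) (lowerPath-near j) (upperPath-near k)

      upper-lower-far : ∀ j k → SetDistGe G (Upper j) (Lower k) Q
      upper-lower-far j k = by-cases (j F.≟ k)
        where
        by-cases : Dec (j ≡ k) → SetDistGe G (Upper j) (Lower k) Q
        by-cases (yes j≡k) = subst (λ i → SetDistGe G (Upper j) (Lower i) Q) j≡k
          (levels-far′ o (Lower j) (Upper j) (reach j (upperPath-near j)) (lowerPath-below j) (upperPath-above j) lower-upper-gap)
        by-cases (no j≢k)  = columns-far j k j≢k (Upper j) (Lower k) (upperPath-near j) (lowerPath-near k)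

      paths-far : ∀ {u v u′ v′} (e : Edge u v) (e′ : Edge u′ v′) → ¬ (u ≡ u′ × v ≡ v′) →
                  SetDistGe G (onPath G (edgePath e)) (onPath G (edgePath e′)) Q
      paths-far (ball–rung j)  (ball–rung k)  ≢ =
        columns-far j k (λ j≡k → ≢ (refl , cong (λ i → F.suc (F.suc i)) j≡k)) (Lower j) (Lower k) (lowerPath-near j) (lowerPath-near k)
      paths-far (chain–rung j) (chain–rung k) ≢ =
        columns-far j k (λ j≡k → ≢ (refl , cong (λ i → F.suc (F.suc i)) j≡k)) (Upper j) (Upper k) (upperPath-near j) (upperPath-near k)
      paths-far (ball–rung j)  (chain–rung k) _ = lower-upper-far j k
      paths-far (chain–rung j) (ball–rung k)  _ = upper-lower-far j k

      path-branch-far : ∀ {u v} (e : Edge u v) w → w ≢ u → w ≢ v → SetDistGe G (onPath G (edgePath e)) (Branch w) Q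
      path-branch-far (ball–rung j)  F.zero             w≢0 _ = ⊥-elim (w≢0 refl)
      path-branch-far (ball–rung j)  (F.suc F.zero)     _ _ =
        levels-far o _ OnChain (reach j (lowerPath-near j)) (lowerPath-below j) (λ v → chain-above sx ch) lower-chain-gap
      path-branch-far (chain–rung j) F.zero             _ _ =
        levels-far′ o Ball _ (reach j (upperPath-near j)) (λ _ → proj₂) (upperPath-above j) ball-upper-gap
      path-branch-far (chain–rung j) (F.suc F.zero)     w≢1 _ = ⊥-elim (w≢1 refl)
      path-branch-far (ball–rung j)  (F.suc (F.suc k)) _ k≢j =
        columns-far j k (λ j≡k → k≢j (cong (λ i → F.suc (F.suc i)) (sym j≡k))) _ _ (lowerPath-near j) (rung-near k)
      path-branch-far (chain–rung j) (F.suc (F.suc k)) _ k≢j =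
        columns-far j k (λ j≡k → k≢j (cong (λ i → F.suc (F.suc i)) (sym j≡k))) _ _ (upperPath-near j) (rung-near k)

      ball-connected : ∀ {u v} → Ball u → Ball v → Σ (Walk G u v) λ w → All Ball (vertices G w)
      ball-connected (ou , u≤) (ov , v≤) =
        reverse (Geodesic.path γu) ++ʷ Geodesic.path γv ,
        All.tabulate λ z∈ → [ (λ z∈r → along γu u≤ (∈-reverse⁻ _ z∈r)) , along γv v≤ ]′ (∈-++⁻ (reverse (Geodesic.path γu)) _ z∈)
        where
        γu = geodesic ou
        γv = geodesic ov
        along : ∀ {v} (γ : Geodesic o v) → H v ≤ t₃ → ∀ {z} → z ∈ vertices G (Geodesic.path γ) → Ball z
        along γ v≤ z∈ = prefix (Geodesic.path γ) z∈ , ≤-trans (geodesic-below γ z∈) v≤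

      branch-connected : ∀ w u v → Branch w u → Branch w v → Σ (Walk G u v) λ w′ → All (Branch w) (vertices G w′)
      branch-connected F.zero             u v = ball-connected
      branch-connected (F.suc F.zero)     u v = connected-within (chainWalk ch)
      branch-connected (F.suc (F.suc j)) u v = connected-within (Col.rung j)

      branch-nonempty : ∀ w → ∃ (Branch w)
      branch-nonempty F.zero             = o , [ o ] , H-root≤ 0≤t₃
      branch-nonempty (F.suc F.zero)     = x , ∈-start (chainWalk ch)
      branch-nonempty (F.suc (F.suc j)) = Col.v₁ j , ∈-start (Col.rung j)

      fatMinor : FatMinor G q (2 ℕ.+ p) (K2-Adj p)
      fatMinor = record
        { T           = Branch
        ; T-disjoint  = λ u v u≢v z zu zv → <⇒≱ 0<Q (branches-far u v u≢v z z zu zv [ z ] ([] ∷ []))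
        ; T-nonempty  = branch-nonempty
        ; T-connected = branch-connected
        ; T-far       = branches-far
        ; P           = λ u v u<v e → edgePath (asEdge u v u<v e)
        ; P-far       = λ u v u′ v′ u<v e u′<v′ e′ → paths-far (asEdge u v u<v e) (asEdge u′ v′ u′<v′ e′)
        ; P-T-far     = λ u v u<v e → path-branch-far (asEdge u v u<v e)
        }

    long-chain⇒fatMinor : ∀ {y} (ch : Chain x y) → D < g y → FatMinor G q (2 ℕ.+ p) (K2-Adj p)
    long-chain⇒fatMinor ch far with ≤-<-connex M L
    ... | inj₁ M≤L = Deep.fatMinor ch far M≤L
    ... | inj₂ L<M = ⊥-elim (<⇒≱ far (<⇒≤ (shallow-stratum-close (origin ch) (chain-end (origin ch) ch) L<M)))

  classes-cover : ∀ v → Class true v ⊎ Class false v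
  classes-cover v with parity (layer v)
  ... | true  = inj₁ refl
  ... | false = inj₂ refl

  class-components-bounded : ¬ FatMinor G q (2 ℕ.+ p) (K2-Adj p) → ∀ b → RComponentsBounded G r D (Class b)
  class-components-bounded noMinor b C (_ , pairwise , _) x y Cx Cy =
    [ (λ close → close) , (λ far → ⊥-elim (noMinor (long-chain⇒fatMinor ch far))) ]′
      (distance-attained-or-exceeds (chainWalk ch) D)
    where
    open Stratum b x
    ch = pairwise x y Cx Cy

lemma7p1 : (Rs : RealNumbers) → (p q : ℕ) → 2 ℕ.≤ p → 1 ℕ.≤ q →
    (r κ : RealNumbers.ℝ Rs) →
    RealNumbers._<_ Rs (RealNumbers.0r Rs) r →
    RealNumbers._<_ Rs (RealNumbers.0r Rs) κ →
    (G : WithReals.WGraph Rs) →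
    WithReals.Weighted0κ Rs G κ →
    ¬ WithReals.FatMinor Rs G q (2 ℕ.+ p) (K2-Adj p) →
    Σ (WithReals.Pred Rs G) λ A → Σ (WithReals.Pred Rs G) λ B →
    (∀ v → A v ⊎ B v) ×
    WithReals.RComponentsBounded Rs G r (fatBound Rs p q r κ) A ×
    WithReals.RComponentsBounded Rs G r (fatBound Rs p q r κ) B
lemma7p1 Rs p q p≥2 q≥1 r κ r>0 κ>0 G wκ noMinor =
  Class true , Class false , classes-cover ,
  class-components-bounded noMinor true , class-components-bounded noMinor false
  where open LayerPartition Rs G p q r κ p≥2 q≥1 r>0 κ>0 wκ
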